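{- Let $d$ be a fixed positive integer. Then, as $n\to\infty$: (i) $\alpha_n^d=n^d-(2^d-1)n^{d-1}+\mathcal{O}(n^{d-2})$; (ii) $\lim_{n\to\infty}\frac{\alpha_n^d}{n^d}=1$; (iii) $\lim_{n\to\infty}\frac{\alpha_{n+1}^d}{\alpha_n^d}=1$.
   Context: $\mathbb{Z}_n$ is the ring of integers modulo $n$; a vector $(v_1,\dots,v_d)\in\mathbb{Z}_n^d$ is zero-sum-free if no non-empty subset of its components sums to $0$ in $\mathbb{Z}_n$; $\alpha_n^d$ is the number of such vectors. $a_n=\mathcal{O}(b_n)$ means there are a constant $K>0$ and an integer $N$ with $|a_n|\leq K b_n$ for all $n\geq N$. -}

module Defs where

open import Data.Bool using (Bool; true; false; not; _∨_)
open import Data.Nat using (ℕ; zero; suc; _+_; _≥_)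
open import Data.Nat.Divisibility using (_∣?_)
open import Data.Fin using (Fin; toℕ)
open import Data.Vec using (Vec; []; _∷_)
open import Data.List using (List; [_]; _∷_; []; map; concatMap; length; filterᵇ; allFin)
open import Data.Bool.ListAction using (all)
open import Data.Product using (∃)
open import Data.Integer using (+_)
open import Data.Rational using (ℚ; 0ℚ; _/_; _-_; _<_; ∣_∣)
open import Relation.Nullary.Decidable using (⌊_⌋)

-- Elements of ℤ_n are represented by Fin n (residues 0,…,n-1);
-- a vector in ℤ_n^d is a Vec (Fin n) d.

allVecs : (n d : ℕ) → List (Vec (Fin n) d)
allVecs n zero    = [ [] ]
allVecs n (suc d) = concatMap (λ x → map (x ∷_) (allVecs n d)) (allFin n)

-- all subsets of the index set {1,…,d}, as characteristic vectors
allSubsets : (d : ℕ) → List (Vec Bool d)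
allSubsets zero    = [ [] ]
allSubsets (suc d) = concatMap (λ b → map (b ∷_) (allSubsets d)) (true ∷ false ∷ [])

nonEmpty : ∀ {d} → Vec Bool d → Bool
nonEmpty []          = false
nonEmpty (b ∷ S)     = b ∨ nonEmpty S

subsetSum : ∀ {n d} → Vec Bool d → Vec (Fin n) d → ℕ
subsetSum []          []       = 0
subsetSum (true ∷ S)  (x ∷ v)  = toℕ x + subsetSum S v
subsetSum (false ∷ S) (x ∷ v)  = subsetSum S v

zeroSumFree : ∀ {n d} → Vec (Fin n) d → Bool
zeroSumFree {n} {d} v =
  all (λ S → not (nonEmpty S) ∨ not ⌊ n ∣? subsetSum S v ⌋) (allSubsets d)

α : (n d : ℕ) → ℕ
α n d = length (filterᵇ zeroSumFree (allVecs n d))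

-- the rational a / b (junk value 0 when b = 0)
fracℕ : ℕ → ℕ → ℚ
fracℕ a zero    = 0ℚ
fracℕ a (suc b) = (+ a) / suc b

Tendsto : (ℕ → ℚ) → ℚ → Set
Tendsto f L = ∀ (ε : ℚ) → 0ℚ < ε → ∃ λ N → ∀ n → n ≥ N → ∣ f n - L ∣ < ε

-- For zero-sum-free v ∈ ℤ_n^d, x ∷ v is zero-sum-free exactly when x avoids the 2^d residues
-- −Σ_{i∈S} v_i, S ⊆ {1,…,d} (S = ∅ included). By Bonferroni the number of such x lies between
-- n − 2^d and n − 2^d + c(v), where c(v) counts the pairs S ≠ T with equal sums, and a fixed pair
-- S ≠ T has equal sums for at most n^(d−1) vectors v. Summing over zero-sum-free v,
--   (n − 2^d) α_n^d ≤ α_n^(d+1) ≤ (n − 2^d) α_n^d + P_d n^(d−1)   (P_d pairs of subsets),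
-- and induction on d gives n^d − (2^d − 1) n^(d−1) ≤ α_n^d ≤ n^d − (2^d − 1) n^(d−1) + C_d n^(d−2).
-- Both α_n^d / n^d and α_(n+1)^d / α_n^d are therefore 1 + O(1/n).

module Submission where

open import Data.Bool using (Bool; true; false; not; _∨_; _∧_)
open import Data.Bool.ListAction using (all)
open import Data.Bool.Properties using (∧-identityʳ; ∧-assoc)
open import Data.Empty using (⊥-elim)
open import Data.Fin using (Fin; toℕ; fromℕ<)
open import Data.Fin.Properties using (toℕ-injective; toℕ-fromℕ<; toℕ<n)
import Data.Integer as ℤ
import Data.Integer.Properties as ℤ
import Data.Integer.Solver as ℤ
open import Data.List using (List; []; _∷_; _++_; map; concatMap; length; filterᵇ; allFin)
open import Data.List.Properties using (length-tabulate)
open import Data.List.Membership.Propositional using (_∈_)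
open import Data.List.Membership.Propositional.Properties using (∈-allFin)
open import Data.List.Relation.Unary.All as All using (All; []; _∷_)
import Data.List.Relation.Unary.All.Properties as All
open import Data.List.Relation.Unary.Any using (here; there)
open import Data.List.Relation.Unary.AllPairs as AllPairs using ([]; _∷_)
import Data.List.Relation.Unary.AllPairs.Properties as AllPairs
open import Data.List.Relation.Unary.Unique.Propositional using (Unique)
open import Data.List.Relation.Unary.Unique.Propositional.Properties using (allFin⁺)
open import Data.Nat hiding (∣_-_∣)
import Data.Nat as ℕ using (∣_-_∣)
open import Data.Nat.Coprimality using (Coprime)
open import Data.Nat.DivMod
open import Data.Nat.Divisibility using (_∣?_; n∣m⇒m%n≡0; m%n≡0⇒n∣m)
open import Data.Nat.Properties
import Data.Nat.Solver as ℕ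
open import Data.Product using (_×_; _,_; ∃₂)
open import Data.Rational using (mkℚ; 1ℚ)
import Data.Rational as ℚ
import Data.Rational.Properties as ℚ
import Data.Rational.Unnormalised as ℚᵘ
import Data.Rational.Unnormalised.Properties as ℚᵘ
open import Data.Sum using (inj₁; inj₂)
open import Data.Vec using (Vec; []; _∷_)
open import Data.Vec.Properties using (∷-injectiveʳ)
open import Function using (id)
open import Relation.Binary.PropositionalEquality
open import Relation.Nullary using (Dec; yes; no; ¬_)
open import Relation.Nullary.Decidable using (⌊_⌋)

open import Defs

private variable A B : Set

ind : Bool → ℕ
ind true  = 1
ind false = 0

ind-∧ : ∀ a b → ind (a ∧ b) ≡ ind a * ind b
ind-∧ true  b = sym (+-identityʳ (ind b))
ind-∧ false b = refl

ind≤1 : ∀ a → ind a ≤ 1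
ind≤1 true  = ≤-refl
ind≤1 false = z≤n

∑ : List A → (A → ℕ) → ℕ
∑ []       f = 0
∑ (x ∷ xs) f = f x + ∑ xs f

infix 5 ∑
syntax ∑ xs (λ x → e) = ∑[ x ∈ xs ] e

length-filterᵇ : (p : A → Bool) (xs : List A) → length (filterᵇ p xs) ≡ ∑[ x ∈ xs ] ind (p x)
length-filterᵇ p []       = refl
length-filterᵇ p (x ∷ xs) with p x
... | true  = cong suc (length-filterᵇ p xs)
... | false = length-filterᵇ p xs

∑-++ : (xs ys : List A) (f : A → ℕ) → ∑ (xs ++ ys) f ≡ ∑ xs f + ∑ ys f
∑-++ []       ys f = refl
∑-++ (x ∷ xs) ys f = trans (cong (f x +_) (∑-++ xs ys f)) (sym (+-assoc (f x) _ _))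

∑-cong : (xs : List A) {f g : A → ℕ} → (∀ x → f x ≡ g x) → ∑ xs f ≡ ∑ xs g
∑-cong []       f≡g = refl
∑-cong (x ∷ xs) f≡g = cong₂ _+_ (f≡g x) (∑-cong xs f≡g)

∑-mono : (xs : List A) {f g : A → ℕ} → (∀ x → f x ≤ g x) → ∑ xs f ≤ ∑ xs g
∑-mono []       f≤g = z≤n
∑-mono (x ∷ xs) f≤g = +-mono-≤ (f≤g x) (∑-mono xs f≤g)

∑-zero : (xs : List A) → ∑[ x ∈ xs ] 0 ≡ 0
∑-zero []       = refl
∑-zero (x ∷ xs) = ∑-zero xs

∑-1 : (xs : List A) → ∑[ x ∈ xs ] 1 ≡ length xs
∑-1 []       = refl
∑-1 (x ∷ xs) = cong suc (∑-1 xs)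

∑-const : (xs : List A) (c : ℕ) → ∑[ x ∈ xs ] c ≡ (∑[ x ∈ xs ] 1) * c
∑-const []       c = refl
∑-const (x ∷ xs) c = cong (c +_) (∑-const xs c)

∑-+ : (xs : List A) (f g : A → ℕ) → ∑[ x ∈ xs ] (f x + g x) ≡ ∑ xs f + ∑ xs g
∑-+ []       f g = refl
∑-+ (x ∷ xs) f g = trans (cong (f x + g x +_) (∑-+ xs f g))
  (solve 4 (λ a b c d → a :+ b :+ (c :+ d) := a :+ c :+ (b :+ d)) refl (f x) (g x) (∑ xs f) (∑ xs g))
  where open ℕ.+-*-Solver

*-∑ : (c : ℕ) (xs : List A) (f : A → ℕ) → c * ∑ xs f ≡ ∑[ x ∈ xs ] (c * f x)
*-∑ c []       f = *-zeroʳ c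
*-∑ c (x ∷ xs) f = trans (*-distribˡ-+ c (f x) (∑ xs f)) (cong (c * f x +_) (*-∑ c xs f))

∑-comm : (xs : List A) (ys : List B) (f : A → B → ℕ) →
         ∑[ x ∈ xs ] ∑[ y ∈ ys ] f x y ≡ ∑[ y ∈ ys ] ∑[ x ∈ xs ] f x y
∑-comm []       ys f = sym (∑-zero ys)
∑-comm (x ∷ xs) ys f = trans (cong (∑ ys (f x) +_) (∑-comm xs ys f)) (sym (∑-+ ys (f x) _))

∑-map : (g : A → B) (xs : List A) (f : B → ℕ) → ∑ (map g xs) f ≡ ∑[ x ∈ xs ] f (g x)
∑-map g []       f = refl
∑-map g (x ∷ xs) f = cong (f (g x) +_) (∑-map g xs f)

∑-concatMap : (g : A → List B) (xs : List A) (f : B → ℕ) →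
              ∑ (concatMap g xs) f ≡ ∑[ x ∈ xs ] ∑ (g x) f
∑-concatMap g []       f = refl
∑-concatMap g (x ∷ xs) f = trans (∑-++ (g x) (concatMap g xs) f) (cong (∑ (g x) f +_) (∑-concatMap g xs f))

∑-mono-All : {P : A → Set} {xs : List A} {f g : A → ℕ} →
             All P xs → (∀ x → P x → f x ≤ g x) → ∑ xs f ≤ ∑ xs g
∑-mono-All []         f≤g = z≤n
∑-mono-All (px ∷ pxs) f≤g = +-mono-≤ (f≤g _ px) (∑-mono-All pxs f≤g)

∑-≥-∈ : (f : A → ℕ) {x : A} {xs : List A} → x ∈ xs → f x ≤ ∑ xs f
∑-≥-∈ f (here refl) = m≤m+n _ _
∑-≥-∈ f {xs = y ∷ xs} (there x∈xs) = ≤-trans (∑-≥-∈ f x∈xs) (m≤n+m _ (f y))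

count-unique-≤1 : (p : A → Bool) {xs : List A} → Unique xs →
                  (∀ x y → p x ≡ true → p y ≡ true → x ≡ y) → ∑[ x ∈ xs ] ind (p x) ≤ 1
count-unique-≤1 p []                 p-unique = z≤n
count-unique-≤1 p {x ∷ xs} (x∉xs ∷ xs!) p-unique with p x in px
... | false = count-unique-≤1 p xs! p-unique
... | true  = s≤s (≤-trans (∑-mono-All {g = λ _ → 0} x∉xs others-fail) (≤-reflexive (∑-zero xs)))
  where
  others-fail : ∀ y → ¬ x ≡ y → ind (p y) ≤ 0
  others-fail y x≢y with p y in py
  ... | false = z≤n
  ... | true  = ⊥-elim (x≢y (p-unique x y px py))

∑pairs : List A → (A → A → ℕ) → ℕ
∑pairs []       f = 0
∑pairs (x ∷ xs) f = ∑ xs (f x) + ∑pairs xs f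

∑pairs-mono : (xs : List A) {f g : A → A → ℕ} → (∀ x y → f x y ≤ g x y) → ∑pairs xs f ≤ ∑pairs xs g
∑pairs-mono []       f≤g = z≤n
∑pairs-mono (x ∷ xs) f≤g = +-mono-≤ (∑-mono xs (f≤g x)) (∑pairs-mono xs f≤g)

∑pairs-mono-Unique : {xs : List A} {f g : A → A → ℕ} → Unique xs →
                     (∀ x y → ¬ x ≡ y → f x y ≤ g x y) → ∑pairs xs f ≤ ∑pairs xs g
∑pairs-mono-Unique []            f≤g = z≤n
∑pairs-mono-Unique (x∉xs ∷ xs!) f≤g = +-mono-≤ (∑-mono-All x∉xs (f≤g _)) (∑pairs-mono-Unique xs! f≤g)

∑-∑pairs-comm : (xs : List A) (ys : List B) (f : B → A → A → ℕ) →
                ∑[ y ∈ ys ] ∑pairs xs (f y) ≡ ∑pairs xs (λ x x′ → ∑[ y ∈ ys ] f y x x′)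
∑-∑pairs-comm []       ys f = ∑-zero ys
∑-∑pairs-comm (x ∷ xs) ys f =
  trans (∑-+ ys _ _) (cong₂ _+_ (∑-comm ys xs (λ y → f y x)) (∑-∑pairs-comm xs ys f))

*-∑pairs : (c : ℕ) (xs : List A) (f : A → A → ℕ) → c * ∑pairs xs f ≡ ∑pairs xs (λ x y → c * f x y)
*-∑pairs c []       f = *-zeroʳ c
*-∑pairs c (x ∷ xs) f = trans (*-distribˡ-+ c _ _) (cong₂ _+_ (*-∑ c xs (f x)) (*-∑pairs c xs f))

∑pairs-const : (xs : List A) (c : ℕ) → ∑pairs xs (λ _ _ → c) ≡ ∑pairs xs (λ _ _ → 1) * c
∑pairs-const []       c = refl
∑pairs-const (x ∷ xs) c =
  trans (cong₂ _+_ (∑-const xs c) (∑pairs-const xs c)) (sym (*-distribʳ-+ c (∑[ y ∈ xs ] 1) _))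

bonferroni-lower : (p : A → Bool) (xs : List A) →
                   1 ≤ ind (all (λ x → not (p x)) xs) + (∑[ x ∈ xs ] ind (p x))
bonferroni-lower p []       = ≤-refl
bonferroni-lower p (x ∷ xs) with p x
... | true  = s≤s z≤n
... | false = bonferroni-lower p xs

bonferroni-upper : (p : A → Bool) (xs : List A) →
                   ind (all (λ x → not (p x)) xs) + (∑[ x ∈ xs ] ind (p x))
                     ≤ 1 + ∑pairs xs (λ x y → ind (p x) * ind (p y))
bonferroni-upper p []       = ≤-refl
bonferroni-upper p (x ∷ xs) with p x
... | true  = s≤s (≤-trans (≤-reflexive (∑-cong xs (λ y → sym (+-identityʳ (ind (p y)))))) (m≤m+n _ _))
... | false = ≤-trans (bonferroni-upper p xs) (≤-reflexive (cong (λ s → 1 + (s + pairs)) (sym (∑-zero xs))))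
  where pairs = ∑pairs xs (λ x y → ind (p x) * ind (p y))

all-++ : (p : A → Bool) (xs ys : List A) → all p (xs ++ ys) ≡ all p xs ∧ all p ys
all-++ p []       ys = refl
all-++ p (x ∷ xs) ys = trans (cong (p x ∧_) (all-++ p xs ys)) (sym (∧-assoc (p x) _ _))

all-map : (p : B → Bool) (g : A → B) (xs : List A) → all p (map g xs) ≡ all (λ x → p (g x)) xs
all-map p g []       = refl
all-map p g (x ∷ xs) = cong (p (g x) ∧_) (all-map p g xs)

isYes⇒ : {P : Set} (P? : Dec P) → ⌊ P? ⌋ ≡ true → P
isYes⇒ (yes p) _ = p

isYes⇐ : {P : Set} (P? : Dec P) → P → ⌊ P? ⌋ ≡ true
isYes⇐ (yes _) _ = refl
isYes⇐ (no ¬p) p = ⊥-elim (¬p p)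

isYes-cong : {P Q : Set} (P? : Dec P) (Q? : Dec Q) → (P → Q) → (Q → P) → ⌊ P? ⌋ ≡ ⌊ Q? ⌋
isYes-cong (yes _) (yes _)  _   _   = refl
isYes-cong (no _)  (no _)   _   _   = refl
isYes-cong (yes p) (no ¬q)  p⇒q _   = ⊥-elim (¬q (p⇒q p))
isYes-cong (no ¬p) (yes q)  _   q⇒p = ⊥-elim (¬p (q⇒p q))

allSubsets-unique : ∀ d → Unique (allSubsets d)
allSubsets-unique zero    = [] ∷ []
allSubsets-unique (suc d) =
  AllPairs.++⁺ (cons⁺ true) (AllPairs.++⁺ (cons⁺ false) [] (All.universal (λ _ → []) _))
    (All.map⁺ (All.universal (λ S → All.++⁺ (All.map⁺ (All.universal (λ T ()) (allSubsets d))) []) (allSubsets d)))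
  where
  cons⁺ : ∀ b → Unique (map (b ∷_) (allSubsets d))
  cons⁺ b = AllPairs.map⁺ (AllPairs.map (λ S≢T b∷S≡b∷T → S≢T (∷-injectiveʳ b∷S≡b∷T)) (allSubsets-unique d))

∑-allSubsets : ∀ d → ∑[ S ∈ allSubsets d ] 1 ≡ 2 ^ d
∑-allSubsets zero    = refl
∑-allSubsets (suc d) = begin
  ∑ (map (true ∷_) Sd ++ (map (false ∷_) Sd ++ [])) (λ _ → 1)
    ≡⟨ ∑-++ (map (true ∷_) Sd) _ _ ⟩
  ∑ (map (true ∷_) Sd) (λ _ → 1) + ∑ (map (false ∷_) Sd ++ []) (λ _ → 1)
    ≡⟨ cong₂ _+_ (∑-map _ Sd _) (trans (∑-++ (map (false ∷_) Sd) [] _) (trans (+-identityʳ _) (∑-map _ Sd _))) ⟩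
  (∑[ S ∈ Sd ] 1) + (∑[ S ∈ Sd ] 1)
    ≡⟨ cong₂ _+_ (∑-allSubsets d) (trans (∑-allSubsets d) (sym (+-identityʳ (2 ^ d)))) ⟩
  2 ^ suc d ∎
  where
  open ≡-Reasoning
  Sd = allSubsets d

subsetPairs : ℕ → ℕ
subsetPairs d = ∑pairs (allSubsets d) (λ _ _ → 1)

module Residues (n : ℕ) .{{_ : NonZero n}} where

  %-cong-+ˡ : ∀ x {a b} → a % n ≡ b % n → (x + a) % n ≡ (x + b) % n
  %-cong-+ˡ x {a} {b} a≡b = begin
    (x + a) % n             ≡⟨ %-distribˡ-+ x a n ⟩
    (x % n + a % n) % n     ≡⟨ cong (λ r → (x % n + r) % n) a≡b ⟩
    (x % n + b % n) % n     ≡⟨ %-distribˡ-+ x b n ⟨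
    (x + b) % n             ∎
    where open ≡-Reasoning

  n∸m%n+m≡[1+m/n]*n : ∀ m → n ∸ m % n + m ≡ suc (m / n) * n
  n∸m%n+m≡[1+m/n]*n m = begin
    n ∸ m % n + m                    ≡⟨ cong (n ∸ m % n +_) (m≡m%n+[m/n]*n m n) ⟩
    n ∸ m % n + (m % n + m / n * n)  ≡⟨ +-assoc (n ∸ m % n) (m % n) _ ⟨
    n ∸ m % n + m % n + m / n * n    ≡⟨ cong (_+ m / n * n) (m∸n+n≡m (m%n≤n m n)) ⟩
    n + m / n * n                    ∎
    where open ≡-Reasoning

  +-cancelˡ-% : ∀ m {a b} → (m + a) % n ≡ (m + b) % n → a % n ≡ b % n
  +-cancelˡ-% m {a} {b} m+a≡m+b = trans (sym (undo a)) (trans (%-cong-+ˡ (n ∸ m % n) m+a≡m+b) (undo b))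
    where
    undo : ∀ c → (n ∸ m % n + (m + c)) % n ≡ c % n
    undo c = begin
      (n ∸ m % n + (m + c)) % n   ≡⟨ cong (_% n) (+-assoc (n ∸ m % n) m c) ⟨
      (n ∸ m % n + m + c) % n     ≡⟨ cong (λ k → (k + c) % n) (n∸m%n+m≡[1+m/n]*n m) ⟩
      (suc (m / n) * n + c) % n   ≡⟨ cong (_% n) (+-comm _ c) ⟩
      (c + suc (m / n) * n) % n   ≡⟨ [m+kn]%n≡m%n c (suc (m / n)) n ⟩
      c % n                       ∎
      where open ≡-Reasoning

  +-cancelʳ-%< : ∀ a {i j} → i < n → j < n → (i + a) % n ≡ (j + a) % n → i ≡ j
  +-cancelʳ-%< a {i} {j} i<n j<n i+a≡j+a = begin
    i          ≡⟨ m<n⇒m%n≡m i<n ⟨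
    i % n      ≡⟨ +-cancelˡ-% a (trans (cong (_% n) (+-comm a i)) (trans i+a≡j+a (cong (_% n) (+-comm j a)))) ⟩
    j % n      ≡⟨ m<n⇒m%n≡m j<n ⟩
    j          ∎
    where open ≡-Reasoning

  [n∸m%n]%n+m≡0 : ∀ m → ((n ∸ m % n) % n + m) % n ≡ 0
  [n∸m%n]%n+m≡0 m = begin
    ((n ∸ m % n) % n + m) % n          ≡⟨ %-distribˡ-+ ((n ∸ m % n) % n) m n ⟩
    ((n ∸ m % n) % n % n + m % n) % n  ≡⟨ cong (λ r → (r + m % n) % n) (m%n%n≡m%n (n ∸ m % n) n) ⟩
    ((n ∸ m % n) % n + m % n) % n      ≡⟨ %-distribˡ-+ (n ∸ m % n) m n ⟨
    (n ∸ m % n + m) % n                ≡⟨ cong (_% n) (n∸m%n+m≡[1+m/n]*n m) ⟩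
    suc (m / n) * n % n                ≡⟨ m*n%n≡0 (suc (m / n)) n ⟩
    0                                  ∎
    where open ≡-Reasoning

  count-translate-≤1 : ∀ a c (p : Fin n → Bool) → (∀ x → p x ≡ true → (toℕ x + a) % n ≡ c) →
                       ∑[ x ∈ allFin n ] ind (p x) ≤ 1
  count-translate-≤1 a c p p⇒≡c = count-unique-≤1 p (allFin⁺ n) λ x y px py →
    toℕ-injective (+-cancelʳ-%< a (toℕ<n x) (toℕ<n y) (trans (p⇒≡c x px) (sym (p⇒≡c y py))))

module Extension (n : ℕ) .{{_ : NonZero n}} where
  open Residues n

  ∑-allVecs-suc : ∀ d (F : Vec (Fin n) (suc d) → ℕ) →
                  ∑ (allVecs n (suc d)) F ≡ ∑[ x ∈ allFin n ] ∑[ v ∈ allVecs n d ] F (x ∷ v)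
  ∑-allVecs-suc d F = trans (∑-concatMap _ (allFin n) F) (∑-cong (allFin n) λ x → ∑-map (x ∷_) (allVecs n d) F)

  ∑-allFin-const : ∀ c → ∑[ x ∈ allFin n ] c ≡ n * c
  ∑-allFin-const c = trans (∑-const (allFin n) c) (cong (_* c) (trans (∑-1 (allFin n)) (length-tabulate {n = n} id)))

  ∑-allVecs-1 : ∀ d → ∑[ v ∈ allVecs n d ] 1 ≡ n ^ d
  ∑-allVecs-1 zero    = refl
  ∑-allVecs-1 (suc d) =
    trans (∑-allVecs-suc d _) (trans (∑-cong (allFin n) λ _ → ∑-allVecs-1 d) (∑-allFin-const (n ^ d)))

  α≡∑ : ∀ d → α n d ≡ ∑[ v ∈ allVecs n d ] ind (zeroSumFree v)
  α≡∑ d = length-filterᵇ zeroSumFree (allVecs n d)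

  α≤n^d : ∀ d → α n d ≤ n ^ d
  α≤n^d d = begin
    α n d                                        ≡⟨ α≡∑ d ⟩
    ∑[ v ∈ allVecs n d ] ind (zeroSumFree v)     ≤⟨ ∑-mono (allVecs n d) (λ v → ind≤1 (zeroSumFree v)) ⟩
    ∑[ v ∈ allVecs n d ] 1                       ≡⟨ ∑-allVecs-1 d ⟩
    n ^ d                                        ∎
    where open ≤-Reasoning

  hits : ∀ {d} → Vec (Fin n) d → Fin n → Vec Bool d → Bool
  hits v x S = ⌊ n ∣? toℕ x + subsetSum S v ⌋

  extends : ∀ {d} → Vec (Fin n) d → Fin n → Bool
  extends {d} v x = all (λ S → not (hits v x S)) (allSubsets d)

  extensions : ∀ {d} → Vec (Fin n) d → ℕ
  extensions v = ∑[ x ∈ allFin n ] ind (extends v x)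

  sameSum : ∀ {d} → Vec (Fin n) d → Vec Bool d → Vec Bool d → Bool
  sameSum v S T = ⌊ subsetSum S v % n ≟ subsetSum T v % n ⌋

  collisions : ∀ {d} → Vec (Fin n) d → ℕ
  collisions {d} v = ∑pairs (allSubsets d) (λ S T → ind (sameSum v S T))

  zeroSumFree-∷ : ∀ {d} x (v : Vec (Fin n) d) → zeroSumFree (x ∷ v) ≡ extends v x ∧ zeroSumFree v
  zeroSumFree-∷ {d} x v = begin
    all F (map (true ∷_) Sd ++ (map (false ∷_) Sd ++ []))
      ≡⟨ all-++ F (map (true ∷_) Sd) _ ⟩
    all F (map (true ∷_) Sd) ∧ all F (map (false ∷_) Sd ++ [])
      ≡⟨ cong₂ _∧_ (all-map F (true ∷_) Sd)
                   (trans (all-++ F (map (false ∷_) Sd) []) (trans (∧-identityʳ _) (all-map F (false ∷_) Sd))) ⟩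
    extends v x ∧ zeroSumFree v ∎
    where
    open ≡-Reasoning
    Sd = allSubsets d
    F : Vec Bool (suc d) → Bool
    F S = not (nonEmpty S) ∨ not ⌊ n ∣? subsetSum S (x ∷ v) ⌋

  α-suc : ∀ d → α n (suc d) ≡ ∑[ v ∈ allVecs n d ] ind (zeroSumFree v) * extensions v
  α-suc d = begin
    α n (suc d)
      ≡⟨ α≡∑ (suc d) ⟩
    ∑[ w ∈ allVecs n (suc d) ] ind (zeroSumFree w)
      ≡⟨ ∑-allVecs-suc d _ ⟩
    ∑[ x ∈ allFin n ] ∑[ v ∈ allVecs n d ] ind (zeroSumFree (x ∷ v))
      ≡⟨ ∑-cong (allFin n) (λ x → ∑-cong (allVecs n d) λ v →
           trans (cong ind (zeroSumFree-∷ x v)) (trans (ind-∧ (extends v x) _) (*-comm _ (ind (zeroSumFree v))))) ⟩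
    ∑[ x ∈ allFin n ] ∑[ v ∈ allVecs n d ] ind (zeroSumFree v) * ind (extends v x)
      ≡⟨ ∑-comm (allFin n) (allVecs n d) _ ⟩
    ∑[ v ∈ allVecs n d ] ∑[ x ∈ allFin n ] ind (zeroSumFree v) * ind (extends v x)
      ≡⟨ ∑-cong (allVecs n d) (λ v → sym (*-∑ (ind (zeroSumFree v)) (allFin n) _)) ⟩
    ∑[ v ∈ allVecs n d ] ind (zeroSumFree v) * extensions v ∎
    where open ≡-Reasoning

  hits⇒%≡0 : ∀ {d} (v : Vec (Fin n) d) S x → hits v x S ≡ true → (toℕ x + subsetSum S v) % n ≡ 0
  hits⇒%≡0 v S x hit = n∣m⇒m%n≡0 _ n (isYes⇒ (n ∣? _) hit)

  count-hits-≤1 : ∀ {d} (v : Vec (Fin n) d) S → ∑[ x ∈ allFin n ] ind (hits v x S) ≤ 1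
  count-hits-≤1 v S = count-translate-≤1 (subsetSum S v) 0 (λ x → hits v x S) (hits⇒%≡0 v S)

  count-hits-≥1 : ∀ {d} (v : Vec (Fin n) d) S → 1 ≤ ∑[ x ∈ allFin n ] ind (hits v x S)
  count-hits-≥1 v S = subst (_≤ ∑[ y ∈ allFin n ] ind (hits v y S)) (cong ind hit)
                        (∑-≥-∈ (λ y → ind (hits v y S)) (∈-allFin x))
    where
    a = subsetSum S v
    x = fromℕ< (m%n<n (n ∸ a % n) n)
    hit : hits v x S ≡ true
    hit = isYes⇐ (n ∣? (toℕ x + a))
            (m%n≡0⇒n∣m _ n (trans (cong (λ i → (i + a) % n) (toℕ-fromℕ< _)) ([n∸m%n]%n+m≡0 a)))

  count-hits-both-≤ : ∀ {d} (v : Vec (Fin n) d) S T →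
                      ∑[ x ∈ allFin n ] ind (hits v x S) * ind (hits v x T) ≤ ind (sameSum v S T)
  count-hits-both-≤ v S T with subsetSum S v % n ≟ subsetSum T v % n
  ... | yes _ = begin
    ∑[ x ∈ allFin n ] ind (hits v x S) * ind (hits v x T)
      ≤⟨ ∑-mono (allFin n) (λ x → ≤-trans (*-monoʳ-≤ (ind (hits v x S)) (ind≤1 (hits v x T)))
                                          (≤-reflexive (*-identityʳ _))) ⟩
    ∑[ x ∈ allFin n ] ind (hits v x S)
      ≤⟨ count-hits-≤1 v S ⟩
    1 ∎
    where open ≤-Reasoning
  ... | no S≢T = ≤-trans (∑-mono (allFin n) never-both) (≤-reflexive (∑-zero (allFin n)))
    where
    never-both : ∀ x → ind (hits v x S) * ind (hits v x T) ≤ 0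
    never-both x with hits v x S in hitS | hits v x T in hitT
    ... | false | _     = z≤n
    ... | true  | false = z≤n
    ... | true  | true  = ⊥-elim (S≢T (+-cancelˡ-% (toℕ x) (trans (hits⇒%≡0 v S x hitS) (sym (hits⇒%≡0 v T x hitT)))))

  extensions-lower : ∀ {d} (v : Vec (Fin n) d) → n ≤ extensions v + 2 ^ d
  extensions-lower {d} v = begin
    n
      ≡⟨ trans (sym (*-identityʳ n)) (sym (∑-allFin-const 1)) ⟩
    ∑[ x ∈ allFin n ] 1
      ≤⟨ ∑-mono (allFin n) (λ x → bonferroni-lower (hits v x) (allSubsets d)) ⟩
    ∑[ x ∈ allFin n ] (ind (extends v x) + (∑[ S ∈ allSubsets d ] ind (hits v x S)))
      ≡⟨ ∑-+ (allFin n) _ _ ⟩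
    extensions v + (∑[ x ∈ allFin n ] ∑[ S ∈ allSubsets d ] ind (hits v x S))
      ≡⟨ cong (extensions v +_) (∑-comm (allFin n) (allSubsets d) _) ⟩
    extensions v + (∑[ S ∈ allSubsets d ] ∑[ x ∈ allFin n ] ind (hits v x S))
      ≤⟨ +-monoʳ-≤ (extensions v) (∑-mono (allSubsets d) (count-hits-≤1 v)) ⟩
    extensions v + (∑[ S ∈ allSubsets d ] 1)
      ≡⟨ cong (extensions v +_) (∑-allSubsets d) ⟩
    extensions v + 2 ^ d ∎
    where open ≤-Reasoning

  extensions-upper : ∀ {d} (v : Vec (Fin n) d) → extensions v + 2 ^ d ≤ n + collisions v
  extensions-upper {d} v = begin
    extensions v + 2 ^ d
      ≡⟨ cong (extensions v +_) (sym (∑-allSubsets d)) ⟩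
    extensions v + (∑[ S ∈ allSubsets d ] 1)
      ≤⟨ +-monoʳ-≤ (extensions v) (∑-mono (allSubsets d) (count-hits-≥1 v)) ⟩
    extensions v + (∑[ S ∈ allSubsets d ] ∑[ x ∈ allFin n ] ind (hits v x S))
      ≡⟨ cong (extensions v +_) (∑-comm (allSubsets d) (allFin n) _) ⟩
    extensions v + (∑[ x ∈ allFin n ] ∑[ S ∈ allSubsets d ] ind (hits v x S))
      ≡⟨ ∑-+ (allFin n) _ _ ⟨
    ∑[ x ∈ allFin n ] (ind (extends v x) + (∑[ S ∈ allSubsets d ] ind (hits v x S)))
      ≤⟨ ∑-mono (allFin n) (λ x → bonferroni-upper (hits v x) (allSubsets d)) ⟩
    ∑[ x ∈ allFin n ] (1 + ∑pairs (allSubsets d) (λ S T → ind (hits v x S) * ind (hits v x T)))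
      ≡⟨ ∑-+ (allFin n) _ _ ⟩
    (∑[ x ∈ allFin n ] 1) + (∑[ x ∈ allFin n ] ∑pairs (allSubsets d) (λ S T → ind (hits v x S) * ind (hits v x T)))
      ≡⟨ cong₂ _+_ (trans (∑-allFin-const 1) (*-identityʳ n)) (∑-∑pairs-comm (allSubsets d) (allFin n) _) ⟩
    n + ∑pairs (allSubsets d) (λ S T → ∑[ x ∈ allFin n ] ind (hits v x S) * ind (hits v x T))
      ≤⟨ +-monoʳ-≤ n (∑pairs-mono (allSubsets d) (count-hits-both-≤ v)) ⟩
    n + collisions v ∎
    where open ≤-Reasoning

  sameSum-shift : ∀ {d} x (v : Vec (Fin n) d) S T → sameSum (x ∷ v) (true ∷ S) (true ∷ T) ≡ sameSum v S T
  sameSum-shift x v S T = isYes-cong (_ ≟ _) (_ ≟ _) (+-cancelˡ-% (toℕ x)) (%-cong-+ˡ (toℕ x))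

  ∑-allVecs-suc-headless : ∀ d (F : Vec (Fin n) (suc d) → ℕ) (G : Vec (Fin n) d → ℕ) →
                           (∀ x v → F (x ∷ v) ≡ G v) → ∑ (allVecs n (suc d)) F ≡ n * ∑ (allVecs n d) G
  ∑-allVecs-suc-headless d F G F≡G = trans (∑-allVecs-suc d F)
    (trans (∑-cong (allFin n) λ x → ∑-cong (allVecs n d) (F≡G x)) (∑-allFin-const _))

  ∑-allVecs-suc-≤ : ∀ d (F : Vec (Fin n) (suc d) → ℕ) →
                    (∀ v → ∑[ x ∈ allFin n ] F (x ∷ v) ≤ 1) → ∑ (allVecs n (suc d)) F ≤ n ^ d
  ∑-allVecs-suc-≤ d F head≤1 = begin
    ∑ (allVecs n (suc d)) F                             ≡⟨ ∑-allVecs-suc d F ⟩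
    ∑[ x ∈ allFin n ] ∑[ v ∈ allVecs n d ] F (x ∷ v)    ≡⟨ ∑-comm (allFin n) (allVecs n d) _ ⟩
    ∑[ v ∈ allVecs n d ] ∑[ x ∈ allFin n ] F (x ∷ v)    ≤⟨ ∑-mono (allVecs n d) head≤1 ⟩
    ∑[ v ∈ allVecs n d ] 1                              ≡⟨ ∑-allVecs-1 d ⟩
    n ^ d                                               ∎
    where open ≤-Reasoning

  -- Strip the common leading coordinates of S and T; where they first differ, at most one value
  -- of that entry of v makes the two sums agree.
  ∑-sameSum : ∀ d (S T : Vec Bool d) → ¬ S ≡ T → n * (∑[ v ∈ allVecs n d ] ind (sameSum v S T)) ≤ n ^ d
  ∑-sameSum zero    []          []          S≢T = ⊥-elim (S≢T refl)
  ∑-sameSum (suc d) (true ∷ S)  (true ∷ T)  S≢T = *-monoʳ-≤ n (≤-trans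
    (≤-reflexive (∑-allVecs-suc-headless d _ _ λ x v → cong ind (sameSum-shift x v S T)))
    (∑-sameSum d S T (λ S≡T → S≢T (cong (true ∷_) S≡T))))
  ∑-sameSum (suc d) (false ∷ S) (false ∷ T) S≢T = *-monoʳ-≤ n (≤-trans
    (≤-reflexive (∑-allVecs-suc-headless d _ _ λ x v → refl))
    (∑-sameSum d S T (λ S≡T → S≢T (cong (false ∷_) S≡T))))
  ∑-sameSum (suc d) (true ∷ S)  (false ∷ T) S≢T = *-monoʳ-≤ n (∑-allVecs-suc-≤ d _ λ v →
    count-translate-≤1 (subsetSum S v) (subsetSum T v % n) _ λ x same → isYes⇒ (_ ≟ _) same)
  ∑-sameSum (suc d) (false ∷ S) (true ∷ T)  S≢T = *-monoʳ-≤ n (∑-allVecs-suc-≤ d _ λ v →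
    count-translate-≤1 (subsetSum T v) (subsetSum S v % n) _ λ x same → sym (isYes⇒ (_ ≟ _) same))

  ∑-collisions : ∀ d → n * (∑[ v ∈ allVecs n d ] collisions v) ≤ subsetPairs d * n ^ d
  ∑-collisions d = begin
    n * (∑[ v ∈ allVecs n d ] collisions v)
      ≡⟨ cong (n *_) (∑-∑pairs-comm (allSubsets d) (allVecs n d) _) ⟩
    n * ∑pairs (allSubsets d) (λ S T → ∑[ v ∈ allVecs n d ] ind (sameSum v S T))
      ≡⟨ *-∑pairs n (allSubsets d) _ ⟩
    ∑pairs (allSubsets d) (λ S T → n * (∑[ v ∈ allVecs n d ] ind (sameSum v S T)))
      ≤⟨ ∑pairs-mono-Unique (allSubsets-unique d) (∑-sameSum d) ⟩
    ∑pairs (allSubsets d) (λ _ _ → n ^ d)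
      ≡⟨ ∑pairs-const (allSubsets d) (n ^ d) ⟩
    subsetPairs d * n ^ d ∎
    where open ≤-Reasoning

  *-α : ∀ c d → c * α n d ≡ ∑[ v ∈ allVecs n d ] ind (zeroSumFree v) * c
  *-α c d = trans (cong (c *_) (α≡∑ d))
    (trans (*-∑ c (allVecs n d) _) (∑-cong (allVecs n d) λ v → *-comm c (ind (zeroSumFree v))))

  α-suc+2^d : ∀ d → α n (suc d) + 2 ^ d * α n d
                    ≡ ∑[ v ∈ allVecs n d ] ind (zeroSumFree v) * (extensions v + 2 ^ d)
  α-suc+2^d d = begin
    α n (suc d) + 2 ^ d * α n d
      ≡⟨ cong₂ _+_ (α-suc d) (*-α (2 ^ d) d) ⟩
    (∑[ v ∈ allVecs n d ] ind (zeroSumFree v) * extensions v) + (∑[ v ∈ allVecs n d ] ind (zeroSumFree v) * 2 ^ d)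
      ≡⟨ ∑-+ (allVecs n d) _ _ ⟨
    ∑[ v ∈ allVecs n d ] (ind (zeroSumFree v) * extensions v + ind (zeroSumFree v) * 2 ^ d)
      ≡⟨ ∑-cong (allVecs n d) (λ v → *-distribˡ-+ (ind (zeroSumFree v)) (extensions v) (2 ^ d)) ⟨
    ∑[ v ∈ allVecs n d ] ind (zeroSumFree v) * (extensions v + 2 ^ d) ∎
    where open ≡-Reasoning

  α-suc-lower : ∀ d → n * α n d ≤ α n (suc d) + 2 ^ d * α n d
  α-suc-lower d = begin
    n * α n d
      ≡⟨ *-α n d ⟩
    ∑[ v ∈ allVecs n d ] ind (zeroSumFree v) * n
      ≤⟨ ∑-mono (allVecs n d) (λ v → *-monoʳ-≤ (ind (zeroSumFree v)) (extensions-lower v)) ⟩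
    ∑[ v ∈ allVecs n d ] ind (zeroSumFree v) * (extensions v + 2 ^ d)
      ≡⟨ α-suc+2^d d ⟨
    α n (suc d) + 2 ^ d * α n d ∎
    where open ≤-Reasoning

  α-suc-upper : ∀ d → n * (α n (suc d) + 2 ^ d * α n d) ≤ n * (n * α n d) + subsetPairs d * n ^ d
  α-suc-upper d = begin
    n * (α n (suc d) + 2 ^ d * α n d)
      ≡⟨ cong (n *_) (α-suc+2^d d) ⟩
    n * (∑[ v ∈ allVecs n d ] ind (zeroSumFree v) * (extensions v + 2 ^ d))
      ≤⟨ *-monoʳ-≤ n (∑-mono (allVecs n d) λ v → *-monoʳ-≤ (ind (zeroSumFree v)) (extensions-upper v)) ⟩
    n * (∑[ v ∈ allVecs n d ] ind (zeroSumFree v) * (n + collisions v))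
      ≡⟨ cong (n *_) (trans (∑-cong (allVecs n d) λ v → *-distribˡ-+ (ind (zeroSumFree v)) n (collisions v))
                            (∑-+ (allVecs n d) _ _)) ⟩
    n * ((∑[ v ∈ allVecs n d ] ind (zeroSumFree v) * n) + (∑[ v ∈ allVecs n d ] ind (zeroSumFree v) * collisions v))
      ≤⟨ *-monoʳ-≤ n (+-mono-≤ (≤-reflexive (sym (*-α n d)))
                              (∑-mono (allVecs n d) λ v → *-monoˡ-≤ (collisions v) (ind≤1 (zeroSumFree v)))) ⟩
    n * (n * α n d + (∑[ v ∈ allVecs n d ] 1 * collisions v))
      ≡⟨ *-distribˡ-+ n (n * α n d) _ ⟩
    n * (n * α n d) + n * (∑[ v ∈ allVecs n d ] 1 * collisions v)
      ≤⟨ +-monoʳ-≤ (n * (n * α n d)) (≤-trans (≤-reflexive (cong (n *_) (∑-cong (allVecs n d) λ v → *-identityˡ _)))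
                                              (∑-collisions d)) ⟩
    n * (n * α n d) + subsetPairs d * n ^ d ∎
    where open ≤-Reasoning

∣m-[n-o]∣≡m+o∸n : ∀ m n o → n ≤ m + o → ℤ.∣ ℤ.+ m ℤ.- (ℤ.+ n ℤ.- ℤ.+ o) ∣ ≡ m + o ∸ n
∣m-[n-o]∣≡m+o∸n m n o n≤m+o = begin
  ℤ.∣ ℤ.+ m ℤ.- (ℤ.+ n ℤ.- ℤ.+ o) ∣   ≡⟨ cong ℤ.∣_∣ (solve 3 (λ m n o → m :- (n :- o) := (m :+ o) :- n)
                                                             refl (ℤ.+ m) (ℤ.+ n) (ℤ.+ o)) ⟩
  ℤ.∣ ℤ.+ m ℤ.+ ℤ.+ o ℤ.- ℤ.+ n ∣     ≡⟨ cong (λ i → ℤ.∣ i ℤ.- ℤ.+ n ∣) (ℤ.pos-+ m o) ⟨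
  ℤ.∣ ℤ.+ (m + o) ℤ.- ℤ.+ n ∣         ≡⟨ cong ℤ.∣_∣ (trans (ℤ.m-n≡m⊖n (m + o) n) (ℤ.⊖-≥ n≤m+o)) ⟩
  m + o ∸ n                           ∎
  where
  open ≡-Reasoning
  open ℤ.+-*-Solver

2^suc∸1 : ∀ k → 2 ^ suc k ∸ 1 ≡ 2 ^ k + (2 ^ k ∸ 1)
2^suc∸1 k = trans (cong (λ t → 2 ^ k + t ∸ 1) (+-identityʳ (2 ^ k))) (+-∸-assoc (2 ^ k) (m^n>0 2 k))

secondOrder : ℕ → ℕ
secondOrder zero    = 0
secondOrder (suc e) = secondOrder e + subsetPairs (suc e) + 2 ^ suc e * (2 ^ suc e ∸ 1)

module Expansion (n : ℕ) .{{_ : NonZero n}} where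
  open Extension n
  open ℕ.+-*-Solver

  α-lower : ∀ e → n ^ suc e ≤ α n (suc e) + (2 ^ suc e ∸ 1) * n ^ e
  α-lower zero    = α-suc-lower 0
  α-lower (suc e) = begin
    n * (n * Q)                       ≤⟨ *-monoʳ-≤ n (α-lower e) ⟩
    n * (Y + δ * Q)                   ≡⟨ solve 4 (λ n Y δ Q → n :* (Y :+ δ :* Q) := n :* Y :+ δ :* (n :* Q)) refl n Y δ Q ⟩
    n * Y + δ * (n * Q)               ≤⟨ +-monoˡ-≤ _ (α-suc-lower (suc e)) ⟩
    X + p * Y + δ * (n * Q)           ≤⟨ +-monoˡ-≤ _ (+-monoʳ-≤ X (*-monoʳ-≤ p (α≤n^d (suc e)))) ⟩
    X + p * (n * Q) + δ * (n * Q)     ≡⟨ solve 4 (λ X p δ M → X :+ p :* M :+ δ :* M := X :+ (p :+ δ) :* M) refl X p δ (n * Q) ⟩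
    X + (p + δ) * (n * Q)             ≡⟨ cong (λ t → X + t * (n * Q)) (2^suc∸1 (suc e)) ⟨
    X + (2 ^ suc (suc e) ∸ 1) * (n * Q) ∎
    where
    open ≤-Reasoning
    Q = n ^ e
    Y = α n (suc e)
    X = α n (suc (suc e))
    p = 2 ^ suc e
    δ = 2 ^ suc e ∸ 1

  α-upper : ∀ e → n * (α n (suc e) + (2 ^ suc e ∸ 1) * n ^ e) ≤ n ^ suc (suc e) + secondOrder e * n ^ e
  α-upper zero    = α-suc-upper 0
  α-upper (suc e) = begin
    n * (X + (2 ^ suc (suc e) ∸ 1) * (n * Q))
      ≡⟨ cong (λ t → n * (X + t * (n * Q))) (2^suc∸1 (suc e)) ⟩
    n * (X + (p + δ) * (n * Q))
      ≡⟨ solve 5 (λ n X p δ Q → n :* (X :+ (p :+ δ) :* (n :* Q))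
                                := n :* (X :+ p :* (n :* Q)) :+ δ :* (n :* (n :* Q))) refl n X p δ Q ⟩
    n * (X + p * (n * Q)) + δ * (n * (n * Q))
      ≤⟨ +-monoˡ-≤ _ (*-monoʳ-≤ n (+-monoʳ-≤ X (*-monoʳ-≤ p (α-lower e)))) ⟩
    n * (X + p * (Y + δ * Q)) + δ * (n * (n * Q))
      ≡⟨ solve 6 (λ n X p δ Q Y → n :* (X :+ p :* (Y :+ δ :* Q)) :+ δ :* (n :* (n :* Q))
                                  := n :* (X :+ p :* Y) :+ (δ :* (n :* (n :* Q)) :+ p :* δ :* (n :* Q))) refl n X p δ Q Y ⟩
    n * (X + p * Y) + (δ * (n * (n * Q)) + p * δ * (n * Q))
      ≤⟨ +-monoˡ-≤ _ (α-suc-upper (suc e)) ⟩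
    n * (n * Y) + P * (n * Q) + (δ * (n * (n * Q)) + p * δ * (n * Q))
      ≡⟨ solve 6 (λ n Y P δ Q p → n :* (n :* Y) :+ P :* (n :* Q) :+ (δ :* (n :* (n :* Q)) :+ p :* δ :* (n :* Q))
                                  := n :* (n :* (Y :+ δ :* Q)) :+ (P :* (n :* Q) :+ p :* δ :* (n :* Q))) refl n Y P δ Q p ⟩
    n * (n * (Y + δ * Q)) + (P * (n * Q) + p * δ * (n * Q))
      ≤⟨ +-monoˡ-≤ _ (*-monoʳ-≤ n (α-upper e)) ⟩
    n * (n * (n * Q) + secondOrder e * Q) + (P * (n * Q) + p * δ * (n * Q))
      ≡⟨ solve 6 (λ n Q C P p δ → n :* (n :* (n :* Q) :+ C :* Q) :+ (P :* (n :* Q) :+ p :* δ :* (n :* Q))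
                                  := n :* (n :* (n :* Q)) :+ (C :+ P :+ p :* δ) :* (n :* Q)) refl n Q (secondOrder e) P p δ ⟩
    n ^ suc (suc (suc e)) + secondOrder (suc e) * n ^ suc e ∎
    where
    open ≤-Reasoning
    Q = n ^ e
    Y = α n (suc e)
    X = α n (suc (suc e))
    p = 2 ^ suc e
    δ = 2 ^ suc e ∸ 1
    P = subsetPairs (suc e)

  α-error : ∀ e → n ^ 2 * ℤ.∣ ℤ.+ α n (suc e) ℤ.- (ℤ.+ (n ^ suc e) ℤ.- ℤ.+ (2 ^ suc e ∸ 1) ℤ.* ℤ.+ (n ^ e)) ∣
                    ≤ secondOrder e * n ^ suc e
  α-error e = begin
    n ^ 2 * ℤ.∣ ℤ.+ Y ℤ.- (ℤ.+ (n ^ suc e) ℤ.- ℤ.+ δ ℤ.* ℤ.+ Q) ∣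
      ≡⟨ cong (λ t → n ^ 2 * ℤ.∣ ℤ.+ Y ℤ.- (ℤ.+ (n ^ suc e) ℤ.- t) ∣) (ℤ.pos-* δ Q) ⟨
    n ^ 2 * ℤ.∣ ℤ.+ Y ℤ.- (ℤ.+ (n ^ suc e) ℤ.- ℤ.+ (δ * Q)) ∣
      ≡⟨ cong (n ^ 2 *_) (∣m-[n-o]∣≡m+o∸n Y (n ^ suc e) (δ * Q) (α-lower e)) ⟩
    n ^ 2 * (Y + δ * Q ∸ n ^ suc e)
      ≡⟨ trans (cong (_* (Y + δ * Q ∸ n ^ suc e)) (cong (n *_) (*-identityʳ n))) (*-assoc n n _) ⟩
    n * (n * (Y + δ * Q ∸ n ^ suc e))
      ≡⟨ cong (n *_) (*-distribˡ-∸ n (Y + δ * Q) (n ^ suc e)) ⟩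
    n * (n * (Y + δ * Q) ∸ n * n ^ suc e)
      ≤⟨ *-monoʳ-≤ n (m≤n+o⇒m∸n≤o _ _ (α-upper e)) ⟩
    n * (secondOrder e * Q)
      ≡⟨ solve 3 (λ n C Q → n :* (C :* Q) := C :* (n :* Q)) refl n (secondOrder e) Q ⟩
    secondOrder e * n ^ suc e ∎
    where
    open ≤-Reasoning
    Q = n ^ e
    Y = α n (suc e)
    δ = 2 ^ suc e ∸ 1

  α-deficit : ∀ e → n * ℕ.∣ α n (suc e) - n ^ suc e ∣ ≤ (2 ^ suc e ∸ 1) * n ^ suc e
  α-deficit e = begin
    n * ℕ.∣ α n (suc e) - n ^ suc e ∣    ≡⟨ cong (n *_) (m≤n⇒∣m-n∣≡n∸m (α≤n^d (suc e))) ⟩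
    n * (n ^ suc e ∸ α n (suc e))        ≤⟨ *-monoʳ-≤ n (m≤n+o⇒m∸n≤o _ _ (α-lower e)) ⟩
    n * (δ * n ^ e)                      ≡⟨ solve 3 (λ n δ Q → n :* (δ :* Q) := δ :* (n :* Q)) refl n δ (n ^ e) ⟩
    δ * n ^ suc e                        ∎
    where
    open ≤-Reasoning
    δ = 2 ^ suc e ∸ 1

  α-≥-half : ∀ e → 2 * (2 ^ suc e ∸ 1) ≤ n → n ^ suc e ≤ 2 * α n (suc e)
  α-≥-half e 2δ≤n = +-cancelʳ-≤ P P (2 * Y) (begin
    P + P                  ≡⟨ solve 1 (λ P → P :+ P := con 2 :* P) refl P ⟩
    2 * P                  ≤⟨ *-monoʳ-≤ 2 (α-lower e) ⟩
    2 * (Y + δ * Q)        ≡⟨ solve 3 (λ Y δ Q → con 2 :* (Y :+ δ :* Q) := con 2 :* Y :+ con 2 :* δ :* Q) refl Y δ Q ⟩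
    2 * Y + 2 * δ * Q      ≤⟨ +-monoʳ-≤ (2 * Y) (*-monoˡ-≤ Q 2δ≤n) ⟩
    2 * Y + P              ∎)
    where
    open ≤-Reasoning
    P = n ^ suc e
    Q = n ^ e
    Y = α n (suc e)
    δ = 2 ^ suc e ∸ 1

∣m⊖n∣≡∣m-n∣ : ∀ m n → ℤ.∣ m ℤ.⊖ n ∣ ≡ ℕ.∣ m - n ∣
∣m⊖n∣≡∣m-n∣ zero    zero    = refl
∣m⊖n∣≡∣m-n∣ zero    (suc n) = refl
∣m⊖n∣≡∣m-n∣ (suc m) zero    = refl
∣m⊖n∣≡∣m-n∣ (suc m) (suc n) = trans (cong ℤ.∣_∣ (ℤ.[1+m]⊖[1+n]≡m⊖n m n)) (∣m⊖n∣≡∣m-n∣ m n)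

-- After cross-multiplying: |a − (b+1)|·(q+1) < b+1 ≤ (p+1)·(b+1).
∣fracℕ-1∣< : ∀ a b p q .(c : Coprime (suc p) (suc q)) → ℕ.∣ a - suc b ∣ * suc q < suc b →
              ℚ.∣ fracℕ a (suc b) ℚ.- 1ℚ ∣ ℚ.< mkℚ (ℤ.+ suc p) q c
∣fracℕ-1∣< a b p q c small =
  ℚ.toℚᵘ-cancel-< (ℚᵘ.<-respˡ-≃ (ℚᵘ.≃-sym toℚᵘ-∣a/b-1∣) (ℚᵘ.*<* (subst₂ ℤ._<_ lhs rhs (ℤ.+<+ small′))))
  where
  x = fracℕ a (suc b)
  ∣a/b-1∣ᵘ = ℚᵘ.∣ ℚᵘ.mkℚᵘ (ℤ.+ a) b ℚᵘ.+ ℚᵘ.mkℚᵘ ℤ.-1ℤ 0 ∣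
  toℚᵘ-∣a/b-1∣ : ℚ.toℚᵘ ℚ.∣ x ℚ.- 1ℚ ∣ ℚᵘ.≃ ∣a/b-1∣ᵘ
  toℚᵘ-∣a/b-1∣ = ℚᵘ.≃-trans (ℚ.toℚᵘ-homo-∣-∣ (x ℚ.- 1ℚ))
    (ℚᵘ.∣-∣-cong (ℚᵘ.≃-trans (ℚ.toℚᵘ-homo-+ x (ℚ.- 1ℚ))
                             (ℚᵘ.+-congˡ (ℚᵘ.mkℚᵘ ℤ.-1ℤ 0) (ℚ.toℚᵘ-fromℚᵘ (ℚᵘ.mkℚᵘ (ℤ.+ a) b)))))
  D = ℕ.∣ a - suc b ∣
  small′ : D * suc q < suc p * (suc b * 1)
  small′ = <-≤-trans small (≤-trans (≤-reflexive (sym (*-identityʳ (suc b)))) (m≤n*m (suc b * 1) (suc p)))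
  numerator : ℤ.∣ ℤ.+ a ℤ.* ℤ.+ 1 ℤ.+ ℤ.-1ℤ ℤ.* ℤ.+ suc b ∣ ≡ D
  numerator = begin
    ℤ.∣ ℤ.+ a ℤ.* ℤ.+ 1 ℤ.+ ℤ.-1ℤ ℤ.* ℤ.+ suc b ∣
      ≡⟨ cong₂ (λ s t → ℤ.∣ s ℤ.+ t ∣) (ℤ.*-identityʳ (ℤ.+ a)) (ℤ.-1*i≡-i (ℤ.+ suc b)) ⟩
    ℤ.∣ ℤ.+ a ℤ.- ℤ.+ suc b ∣
      ≡⟨ cong ℤ.∣_∣ (ℤ.m-n≡m⊖n a (suc b)) ⟩
    ℤ.∣ a ℤ.⊖ suc b ∣
      ≡⟨ ∣m⊖n∣≡∣m-n∣ a (suc b) ⟩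
    D ∎
    where open ≡-Reasoning
  lhs : ℤ.+ (D * suc q) ≡ ℚᵘ.↥ ∣a/b-1∣ᵘ ℤ.* ℤ.+ suc q
  lhs = trans (ℤ.pos-* D (suc q)) (cong (λ t → ℤ.+ t ℤ.* ℤ.+ suc q) (sym numerator))
  rhs : ℤ.+ (suc p * (suc b * 1)) ≡ ℤ.+ suc p ℤ.* ℚᵘ.↧ ∣a/b-1∣ᵘ
  rhs = ℤ.pos-* (suc p) (suc b * 1)

archimedean-step : ∀ m M Q D b .{{_ : NonZero b}} → m * D ≤ M * b → M * Q < m → D * Q < b
archimedean-step m M Q D b mD≤Mb MQ<m = *-cancelˡ-< m (D * Q) b (begin-strict
  m * (D * Q)   ≡⟨ *-assoc m D Q ⟨
  m * D * Q     ≤⟨ *-monoˡ-≤ Q mD≤Mb ⟩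
  M * b * Q     ≡⟨ solve 3 (λ M b Q → M :* b :* Q := M :* Q :* b) refl M b Q ⟩
  M * Q * b     <⟨ *-monoˡ-< b MQ<m ⟩
  m * b         ∎)
  where
  open ≤-Reasoning
  open ℕ.+-*-Solver

fracℕ→1 : (a b : ℕ → ℕ) (N M : ℕ) → (∀ m → m ≥ N → 1 ≤ b m × m * ℕ.∣ a m - b m ∣ ≤ M * b m) →
          Tendsto (λ m → fracℕ (a m) (b m)) 1ℚ
fracℕ→1 a b N M close (mkℚ (ℤ.+ zero) q c)   (ℚ.*<* (ℤ.+<+ ()))
fracℕ→1 a b N M close (mkℚ ℤ.-[1+ k ] q c)   (ℚ.*<* ())
fracℕ→1 a b N M close (mkℚ (ℤ.+ suc p) q c) _ = N ⊔ suc (M * suc q) , λ m m≥ →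
  within (a m) (b m) (close m (≤-trans (m≤m⊔n N _) m≥)) (≤-trans (m≤n⊔m N _) m≥)
  where
  within : ∀ {m} x y → 1 ≤ y × m * ℕ.∣ x - y ∣ ≤ M * y → M * suc q < m →
           ℚ.∣ fracℕ x y ℚ.- 1ℚ ∣ ℚ.< mkℚ (ℤ.+ suc p) q c
  within x (suc y) (_ , close) Mq<m = ∣fracℕ-1∣< x y p q c (archimedean-step _ M (suc q) _ (suc y) close Mq<m)

suc-^-≤ : ∀ k e → suc (suc k) ^ suc e ≤ suc k ^ suc e + 3 ^ e * suc k ^ e
suc-^-≤ k zero    = ≤-reflexive (+-comm 1 (suc k * 1))
suc-^-≤ k (suc e) = begin
  suc m * suc m ^ suc e
    ≤⟨ *-monoʳ-≤ (suc m) (suc-^-≤ k e) ⟩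
  suc m * (m ^ suc e + T * m ^ e)
    ≡⟨ solve 3 (λ m T Q → (con 1 :+ m) :* (m :* Q :+ T :* Q) := m :* (m :* Q) :+ (m :* Q :+ T :* (m :* Q)) :+ T :* Q)
             refl m T (m ^ e) ⟩
  m ^ suc (suc e) + (m ^ suc e + T * m ^ suc e) + T * m ^ e
    ≤⟨ +-monoʳ-≤ _ (*-monoʳ-≤ T (m≤n*m (m ^ e) m)) ⟩
  m ^ suc (suc e) + (m ^ suc e + T * m ^ suc e) + T * m ^ suc e
    ≡⟨ solve 3 (λ Y X T → Y :+ (X :+ T :* X) :+ T :* X := Y :+ (con 1 :+ con 2 :* T) :* X) refl (m ^ suc (suc e)) (m ^ suc e) T ⟩
  m ^ suc (suc e) + (1 + 2 * T) * m ^ suc e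
    ≤⟨ +-monoʳ-≤ _ (*-monoˡ-≤ (m ^ suc e) (+-monoˡ-≤ (2 * T) (m^n>0 3 e))) ⟩
  m ^ suc (suc e) + (T + 2 * T) * m ^ suc e
    ≡⟨ cong (λ t → m ^ suc (suc e) + t * m ^ suc e) (solve 1 (λ T → T :+ con 2 :* T := con 3 :* T) refl T) ⟩
  m ^ suc (suc e) + 3 ^ suc e * m ^ suc e ∎
  where
  open ≤-Reasoning
  open ℕ.+-*-Solver
  m = suc k
  T = 3 ^ e

suc-^-≤-2^ : ∀ k e → suc (suc k) ^ e ≤ 2 ^ e * suc k ^ e
suc-^-≤-2^ k zero    = ≤-refl
suc-^-≤-2^ k (suc e) = begin
  suc m * suc m ^ e         ≤⟨ *-mono-≤ (s≤s (m≤n+m m k)) (suc-^-≤-2^ k e) ⟩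
  (m + m) * (2 ^ e * m ^ e) ≡⟨ solve 3 (λ m T Q → (m :+ m) :* (T :* Q) := (con 2 :* T) :* (m :* Q)) refl m (2 ^ e) (m ^ e) ⟩
  2 ^ suc e * m ^ suc e     ∎
  where
  open ≤-Reasoning
  open ℕ.+-*-Solver
  m = suc k

∣m-n∣≤[m∸n]+[n∸m] : ∀ m n → ℕ.∣ m - n ∣ ≤ (m ∸ n) + (n ∸ m)
∣m-n∣≤[m∸n]+[n∸m] m n with ∣m-n∣≡[m∸n]∨[n∸m] m n
... | inj₁ ∣m-n∣≡m∸n = ≤-trans (≤-reflexive ∣m-n∣≡m∸n) (m≤m+n _ _)
... | inj₂ ∣m-n∣≡n∸m = ≤-trans (≤-reflexive ∣m-n∣≡n∸m) (m≤n+m _ _)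

α-successive : ∀ e k → 2 * (2 ^ suc e ∸ 1) ≤ k →
               1 ≤ α (suc k) (suc e)
               × suc k * ℕ.∣ α (suc (suc k)) (suc e) - α (suc k) (suc e) ∣
                   ≤ 2 * (2 ^ suc e ∸ 1 + 3 ^ e + (2 ^ suc e ∸ 1) * 2 ^ e) * α (suc k) (suc e)
α-successive e k 2δ≤k = Y≥1 , (begin
  n * ℕ.∣ X - Y ∣                      ≤⟨ *-monoʳ-≤ n (≤-trans (∣m-n∣≤[m∸n]+[n∸m] X Y) (+-mono-≤ increase decrease)) ⟩
  n * ((δ + 3 ^ e) * Q + δ * 2 ^ e * Q) ≡⟨ solve 5 (λ n δ T U Q → n :* ((δ :+ T) :* Q :+ δ :* U :* Q) := (δ :+ T :+ δ :* U) :* (n :* Q))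
                                                 refl n δ (3 ^ e) (2 ^ e) Q ⟩
  K * P                                ≤⟨ *-monoʳ-≤ K P≤2Y ⟩
  K * (2 * Y)                          ≡⟨ solve 2 (λ K Y → K :* (con 2 :* Y) := con 2 :* K :* Y) refl K Y ⟩
  2 * K * Y                            ∎)
  where
  open ≤-Reasoning
  open ℕ.+-*-Solver
  n = suc k
  d = suc e
  δ = 2 ^ d ∸ 1
  K = δ + 3 ^ e + δ * 2 ^ e
  Q = n ^ e
  P = n ^ d
  Y = α n d
  X = α (suc n) d
  P≤2Y : P ≤ 2 * Y
  P≤2Y = Expansion.α-≥-half n e (≤-trans 2δ≤k (n≤1+n k))
  Y≥1 : 1 ≤ Y
  Y≥1 = *-cancelˡ-< 2 0 Y (≤-trans (m^n>0 n d) P≤2Y)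
  increase : X ∸ Y ≤ (δ + 3 ^ e) * Q
  increase = m≤n+o⇒m∸n≤o X Y (begin
    X                       ≤⟨ Extension.α≤n^d (suc n) d ⟩
    suc n ^ d               ≤⟨ suc-^-≤ k e ⟩
    P + 3 ^ e * Q           ≤⟨ +-monoˡ-≤ _ (Expansion.α-lower n e) ⟩
    Y + δ * Q + 3 ^ e * Q   ≡⟨ solve 4 (λ Y δ T Q → Y :+ δ :* Q :+ T :* Q := Y :+ (δ :+ T) :* Q) refl Y δ (3 ^ e) Q ⟩
    Y + (δ + 3 ^ e) * Q     ∎)
  decrease : Y ∸ X ≤ δ * 2 ^ e * Q
  decrease = m≤n+o⇒m∸n≤o Y X (begin
    Y                       ≤⟨ Extension.α≤n^d n d ⟩
    P                       ≤⟨ ^-monoˡ-≤ d (n≤1+n n) ⟩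
    suc n ^ d               ≤⟨ Expansion.α-lower (suc n) e ⟩
    X + δ * suc n ^ e       ≤⟨ +-monoʳ-≤ X (*-monoʳ-≤ δ (suc-^-≤-2^ k e)) ⟩
    X + δ * (2 ^ e * Q)     ≡⟨ cong (X +_) (*-assoc δ (2 ^ e) Q) ⟨
    X + δ * 2 ^ e * Q       ∎)

α-second-order : ∀ e → ∃₂ λ K N → ∀ n → n ≥ N →
  n ^ 2 * ℤ.∣ ℤ.+ α n (suc e) ℤ.- (ℤ.+ (n ^ suc e) ℤ.- ℤ.+ (2 ^ suc e ∸ 1) ℤ.* ℤ.+ (n ^ e)) ∣ ≤ K * n ^ suc e
α-second-order e = secondOrder e , 1 , λ { (suc k) _ → Expansion.α-error (suc k) e }

α/n^d→1 : ∀ e → Tendsto (λ n → fracℕ (α n (suc e)) (n ^ suc e)) 1ℚ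
α/n^d→1 e = fracℕ→1 (λ n → α n (suc e)) (λ n → n ^ suc e) 1 (2 ^ suc e ∸ 1)
  λ { (suc k) _ → m^n>0 (suc k) (suc e) , Expansion.α-deficit (suc k) e }

α-ratio→1 : ∀ e → Tendsto (λ n → fracℕ (α (n + 1) (suc e)) (α n (suc e))) 1ℚ
α-ratio→1 e = fracℕ→1 (λ n → α (n + 1) d) (λ n → α n d) (suc (2 * δ)) (2 * (δ + 3 ^ e + δ * 2 ^ e))
  successive
  where
  d = suc e
  δ = 2 ^ d ∸ 1
  successive : ∀ m → m ≥ suc (2 * δ) →
               1 ≤ α m d × m * ℕ.∣ α (m + 1) d - α m d ∣ ≤ 2 * (δ + 3 ^ e + δ * 2 ^ e) * α m d
  successive (suc k) (s≤s 2δ≤k) rewrite +-comm k 1 = α-successive e k 2δ≤k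

open import Data.Integer using (+_; ∣_∣; _-_)

theorem6p1 : (d : ℕ) → d ≥ 1 →
    (∃₂ λ K N → ∀ n → n ≥ N →
        (n ^ 2) * ∣ (+ α n d) - ((+ (n ^ d)) - (+ (2 ^ d ∸ 1)) Data.Integer.* (+ (n ^ (d ∸ 1)))) ∣
          ≤ K * (n ^ d))
    × Tendsto (λ n → fracℕ (α n d) (n ^ d)) 1ℚ
    × Tendsto (λ n → fracℕ (α (n Data.Nat.+ 1) d) (α n d)) 1ℚ
theorem6p1 (suc e) _ = α-second-order e , α/n^d→1 e , α-ratio→1 e
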